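{- Let $K$ be a field of characteristic $0$ and let $M$ be a $2\times(n+1)$ multiplicity matrix (columns indexed $0,\ldots,n$) of the form \[M=\begin{pmatrix}\mu_{1,0}&\mu_{1,1}&\cdots&\mu_{1,n-4}&2&1&0&0\\ \mu_{2,0}&\mu_{2,1}&\cdots&\mu_{2,n-4}&1&0&1&0\end{pmatrix},\] i.e. its last four columns are $\begin{pmatrix}2&1&0&0\\1&0&1&0\end{pmatrix}$. There exist no polynomial $f(x)\in K[x]$ and no sequence $\Lambda=(\lambda_1,\lambda_2)$ of distinct elements of $K$ such that $M=M_f(\Lambda)$.
   Context: For a polynomial $f$ of degree $d$ and a sequence $\Lambda=(\lambda_1,\ldots,\lambda_m)$ of distinct elements of $K$, the multiplicity matrix $M_f(\Lambda)$ is the $m\times(d+1)$ matrix (rows $i\in\{1,\ldots,m\}$, columns $j\in\{0,\ldots,d\}$) whose $(i,j)$ entry is the multiplicity of $\lambda_i$ as a zero of $f^{(j)}(x)$ (which is $0$ if $f^{(j)}(\lambda_i)\neq0$). An $m\times(n+1)$ multiplicity matrix is a matrix $(\mu_{i,j})$ of nonnegative integers (columns $j=0,\ldots,n$) such that each row satisfies $\mu_{i,n}=0$ and $\mu_{i,j}\ge1\Rightarrow\mu_{i,j+1}=\mu_{i,j}-1$, and $\sum_{i=1}^m\mu_{i,j}\le n-j$ for all $j$. -}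

module Defs where

open import Level using (Level; _⊔_)
open import Algebra.Bundles using (CommutativeRing)
open import Data.Nat as ℕ using (ℕ; zero; suc; _∸_; _≤_)
open import Data.Fin as Fin using (Fin; toℕ)
open import Data.List using (List; []; _∷_; length)
open import Data.Product using (Σ; ∃; _×_; _,_)
open import Relation.Nullary using (¬_)
open import Data.Empty using (⊥)
open import Relation.Binary.PropositionalEquality using (_≡_)

record Field (c ℓ : Level) : Set (Level.suc (c ⊔ ℓ)) where
  field
    commutativeRing : CommutativeRing c ℓ
  open CommutativeRing commutativeRing public
  field
    0≉1     : ¬ (0# ≈ 1#)
    inverse : ∀ x → ¬ (x ≈ 0#) → ∃ λ y → (x * y) ≈ 1#

module FieldTheory {c ℓ : Level} (F : Field c ℓ) where
  open Field F

  _·_ : ℕ → Carrier → Carrier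
  zero  · x = 0#
  suc n · x = x + (n · x)

  CharZero : Set ℓ
  CharZero = ∀ (n : ℕ) → (suc n · 1#) ≈ 0# → ⊥

  -- Polynomials in K[x]: coefficient lists, lowest degree first.
  Poly : Set c
  Poly = List Carrier

  coeff : Poly → ℕ → Carrier
  coeff []       _       = 0#
  coeff (a ∷ f)  zero    = a
  coeff (a ∷ f)  (suc i) = coeff f i

  -- equality of polynomials (coefficientwise; trailing zeros irrelevant)
  _≈ₚ_ : Poly → Poly → Set ℓ
  f ≈ₚ g = ∀ i → coeff f i ≈ coeff g i

  _+ₚ_ : Poly → Poly → Poly
  []      +ₚ g       = g
  (a ∷ f) +ₚ []      = a ∷ f
  (a ∷ f) +ₚ (b ∷ g) = (a + b) ∷ (f +ₚ g)

  scale : Carrier → Poly → Poly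
  scale a []      = []
  scale a (b ∷ f) = (a * b) ∷ scale a f

  _*ₚ_ : Poly → Poly → Poly
  []      *ₚ g = []
  (a ∷ f) *ₚ g = scale a g +ₚ (0# ∷ (f *ₚ g))

  HasDegree : Poly → ℕ → Set ℓ
  HasDegree f d = (length f ≡ suc d) × ¬ (coeff f d ≈ 0#)

  derivFrom : ℕ → Poly → Poly
  derivFrom k []      = []
  derivFrom k (a ∷ f) = (k · a) ∷ derivFrom (suc k) f

  deriv : Poly → Poly
  deriv []      = []
  deriv (a ∷ f) = derivFrom 1 f

  deriv^ : ℕ → Poly → Poly
  deriv^ zero    f = f
  deriv^ (suc j) f = deriv (deriv^ j f)

  X-_ : Carrier → Poly
  X- λ' = (- λ') ∷ 1# ∷ []

  _^ₚ_ : Poly → ℕ → Poly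
  p ^ₚ zero  = 1# ∷ []
  p ^ₚ suc k = p *ₚ (p ^ₚ k)

  _∣ₚ_ : Poly → Poly → Set (c ⊔ ℓ)
  p ∣ₚ g = ∃ λ q → g ≈ₚ (p *ₚ q)

  -- λ is a zero of g of multiplicity exactly k
  -- ((x-λ)^k divides g but (x-λ)^(k+1) does not; k = 0 iff g(λ) ≠ 0)
  Multiplicity : Poly → Carrier → ℕ → Set (c ⊔ ℓ)
  Multiplicity g λ' k = ((X- λ') ^ₚ k) ∣ₚ g × ¬ (((X- λ') ^ₚ suc k) ∣ₚ g)

  -- M = M_f(Λ) for f of degree d: f has degree d and every entry
  -- M i j is the multiplicity of λ_i as a zero of f^(j)
  IsMultMatrixOf : {m d : ℕ} → (Fin m → Fin (suc d) → ℕ) → Poly → (Fin m → Carrier) → Set (c ⊔ ℓ)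
  IsMultMatrixOf {m} {d} M f Λ =
    HasDegree f d × (∀ i j → Multiplicity (deriv^ (toℕ j) f) (Λ i) (M i j))

  Distinct : {m : ℕ} → (Fin m → Carrier) → Set ℓ
  Distinct Λ = ∀ i j → ¬ (i ≡ j) → ¬ (Λ i ≈ Λ j)

colSum : {m n : ℕ} → (Fin m → Fin n → ℕ) → Fin n → ℕ
colSum {zero}  M j = 0
colSum {suc m} M j = M Fin.zero j ℕ.+ colSum (λ i → M (Fin.suc i)) j

IsMultiplicityMatrix : {m n : ℕ} → (Fin m → Fin (suc n) → ℕ) → Set
IsMultiplicityMatrix {m} {n} M =
  (∀ i → M i (Fin.fromℕ n) ≡ 0) ×
  (∀ i (j : Fin n) → 1 ≤ M i (Fin.inject₁ j) → M i (Fin.suc j) ≡ M i (Fin.inject₁ j) ∸ 1) ×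
  (∀ (j : Fin (suc n)) → colSum M j ≤ n ∸ toℕ j)

-- Put g = f^(n-3), a cubic since char K = 0. The positive entries of columns n-3, n-2, n-1 say
-- that λ₁ is a double root of g and λ₂ a root of g and of g''. Taylor expansion of g at λ₁ gives, with d = λ₂ - λ₁,
--   2 g(λ₂) + 4 h₃ d³ = 2 g(λ₁) + 2 d g'(λ₁) + d² g''(λ₂),
-- where h₃ ≠ 0 is the leading coefficient of g, so 4 h₃ d³ = 0, which is impossible.
module Submission where

open import Defs
open import Level using (Level)
open import Data.Nat using (ℕ; suc; _≤_; _∸_)
open import Data.Fin using (Fin; toℕ; zero; suc)
open import Data.Product using (Σ; ∃; _×_)
open import Relation.Nullary using (¬_)
open import Relation.Binary.PropositionalEquality using (_≡_)

import Data.Nat as ℕ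
open import Data.Nat.Properties using (suc-injective; +-suc; +-comm; m<n+m)
open import Data.Fin using (fromℕ<)
open import Data.Fin.Properties using (toℕ-fromℕ<)
open import Data.Product using (_,_; proj₁; proj₂)
open import Data.List using (List; []; _∷_; length)
open import Function using (_∘_)
import Relation.Binary.PropositionalEquality as ≡
import Algebra.Properties.Group as GroupProperties
import Algebra.Properties.AbelianGroup as AbelianGroupProperties
import Relation.Binary.Reasoning.Setoid as SetoidReasoning

module _ {c ℓ : Level} (F : Field c ℓ) where
  open Field F hiding (zero)
  open FieldTheory F
  open SetoidReasoning setoid
  open import Algebra.Solver.Ring.NaturalCoefficients.Default commutativeSemiring
  open GroupProperties +-group using (x∙y⁻¹≈ε⇒x≈y)
  open AbelianGroupProperties +-abelianGroup using (xyx⁻¹≈y)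

  x≈0⇒y≈0⇒x+y≈0 : ∀ {x y} → x ≈ 0# → y ≈ 0# → x + y ≈ 0#
  x≈0⇒y≈0⇒x+y≈0 x≈0 y≈0 = trans (+-cong x≈0 y≈0) (+-identityʳ 0#)

  y≈0⇒x*y≈0 : ∀ x {y} → y ≈ 0# → x * y ≈ 0#
  y≈0⇒x*y≈0 x y≈0 = trans (*-congˡ y≈0) (zeroʳ x)

  x≉0⇒y≉0⇒x*y≉0 : ∀ {x y} → ¬ x ≈ 0# → ¬ y ≈ 0# → ¬ x * y ≈ 0#
  x≉0⇒y≉0⇒x*y≉0 {x} {y} x≉0 y≉0 xy≈0 with inverse x x≉0
  ... | x⁻¹ , xx⁻¹≈1 = y≉0 (begin
    y                ≈⟨ *-identityˡ y ⟨
    1# * y           ≈⟨ *-congʳ xx⁻¹≈1 ⟨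
    (x * x⁻¹) * y    ≈⟨ solve 3 (λ x x⁻¹ y → (x :* x⁻¹) :* y := x⁻¹ :* (x :* y)) refl x x⁻¹ y ⟩
    x⁻¹ * (x * y)    ≈⟨ y≈0⇒x*y≈0 x⁻¹ xy≈0 ⟩
    0#               ∎)

  k·x≈[k·1]*x : ∀ k x → k · x ≈ (k · 1#) * x
  k·x≈[k·1]*x 0       x = sym (zeroˡ x)
  k·x≈[k·1]*x (suc k) x = begin
    x + k · x              ≈⟨ +-cong (sym (*-identityˡ x)) (k·x≈[k·1]*x k x) ⟩
    1# * x + (k · 1#) * x  ≈⟨ distribʳ x 1# (k · 1#) ⟨
    (1# + k · 1#) * x      ∎

  x≈0⇒k·x≈0 : ∀ k {x} → x ≈ 0# → k · x ≈ 0#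
  x≈0⇒k·x≈0 k x≈0 = trans (k·x≈[k·1]*x k _) (y≈0⇒x*y≈0 (k · 1#) x≈0)

  eval : Poly → Carrier → Carrier
  eval []      x = 0#
  eval (a ∷ f) x = a + x * eval f x

  eval-congˡ : ∀ f {x y} → x ≈ y → eval f x ≈ eval f y
  eval-congˡ []      x≈y = refl
  eval-congˡ (a ∷ f) x≈y = +-congˡ (*-cong x≈y (eval-congˡ f x≈y))

  eval-zero : ∀ f x → (∀ i → coeff f i ≈ 0#) → eval f x ≈ 0#
  eval-zero []      x f≈0 = refl
  eval-zero (a ∷ f) x f≈0 =
    x≈0⇒y≈0⇒x+y≈0 (f≈0 0) (y≈0⇒x*y≈0 x (eval-zero f x (f≈0 ∘ suc)))

  eval-congʳ : ∀ f g x → f ≈ₚ g → eval f x ≈ eval g x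
  eval-congʳ []      []      x f≈g = refl
  eval-congʳ []      (b ∷ g) x f≈g = sym (eval-zero (b ∷ g) x (sym ∘ f≈g))
  eval-congʳ (a ∷ f) []      x f≈g = eval-zero (a ∷ f) x f≈g
  eval-congʳ (a ∷ f) (b ∷ g) x f≈g = +-cong (f≈g 0) (*-congˡ (eval-congʳ f g x (f≈g ∘ suc)))

  eval-scale : ∀ a f x → eval (scale a f) x ≈ a * eval f x
  eval-scale a []      x = sym (zeroʳ a)
  eval-scale a (b ∷ f) x = begin
    a * b + x * eval (scale a f) x  ≈⟨ +-congˡ (*-congˡ (eval-scale a f x)) ⟩
    a * b + x * (a * eval f x)      ≈⟨ solve 4 (λ a b x e → a :* b :+ x :* (a :* e) := a :* (b :+ x :* e))
                                             refl a b x (eval f x) ⟩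
    a * (b + x * eval f x)          ∎

  eval-+ₚ : ∀ f g x → eval (f +ₚ g) x ≈ eval f x + eval g x
  eval-+ₚ []      g       x = sym (+-identityˡ _)
  eval-+ₚ (a ∷ f) []      x = sym (+-identityʳ _)
  eval-+ₚ (a ∷ f) (b ∷ g) x = begin
    (a + b) + x * eval (f +ₚ g) x              ≈⟨ +-congˡ (*-congˡ (eval-+ₚ f g x)) ⟩
    (a + b) + x * (eval f x + eval g x)        ≈⟨ solve 5 (λ a b x u v →
                                                    (a :+ b) :+ x :* (u :+ v) := (a :+ x :* u) :+ (b :+ x :* v))
                                                    refl a b x (eval f x) (eval g x) ⟩
    (a + x * eval f x) + (b + x * eval g x)    ∎

  eval-*ₚ : ∀ f g x → eval (f *ₚ g) x ≈ eval f x * eval g x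
  eval-*ₚ []      g x = sym (zeroˡ _)
  eval-*ₚ (a ∷ f) g x = begin
    eval (scale a g +ₚ (0# ∷ (f *ₚ g))) x          ≈⟨ eval-+ₚ (scale a g) (0# ∷ (f *ₚ g)) x ⟩
    eval (scale a g) x + (0# + x * eval (f *ₚ g) x) ≈⟨ +-cong (eval-scale a g x) (+-congˡ (*-congˡ (eval-*ₚ f g x))) ⟩
    a * eval g x + (0# + x * (eval f x * eval g x)) ≈⟨ solve 4 (λ a x u v →
                                                        a :* v :+ (con 0 :+ x :* (u :* v)) := (a :+ x :* u) :* v)
                                                        refl a x (eval f x) (eval g x) ⟩
    (a + x * eval f x) * eval g x                   ∎

  eval-X- : ∀ a → eval (X- a) a ≈ 0#
  eval-X- a = begin
    - a + a * (1# + a * 0#) ≈⟨ +-congˡ (*-congˡ (trans (+-congˡ (zeroʳ a)) (+-identityʳ 1#))) ⟩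
    - a + a * 1#            ≈⟨ +-congˡ (*-identityʳ a) ⟩
    - a + a                 ≈⟨ -‿inverseˡ a ⟩
    0#                      ∎

  divisor-root : ∀ a k g → ((X- a) ^ₚ suc k) ∣ₚ g → eval g a ≈ 0#
  divisor-root a k g (q , g≈pq) = begin
    eval g a                                    ≈⟨ eval-congʳ g (((X- a) *ₚ p) *ₚ q) a g≈pq ⟩
    eval (((X- a) *ₚ p) *ₚ q) a                 ≈⟨ eval-*ₚ ((X- a) *ₚ p) q a ⟩
    eval ((X- a) *ₚ p) a * eval q a             ≈⟨ *-congʳ (eval-*ₚ (X- a) p a) ⟩
    (eval (X- a) a * eval p a) * eval q a       ≈⟨ *-congʳ (*-congʳ (eval-X- a)) ⟩
    (0# * eval p a) * eval q a                  ≈⟨ trans (*-congʳ (zeroˡ _)) (zeroˡ _) ⟩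
    0#                                          ∎
    where
    p = (X- a) ^ₚ k

  cubic-taylor : ∀ h₀ h₁ h₂ h₃ a d → let g = h₀ ∷ h₁ ∷ h₂ ∷ h₃ ∷ [] in
    2 · eval g (a + d) + 4 · (h₃ * (d * (d * d)))
      ≈ 2 · eval g a + d * (2 · eval (deriv g) a) + (d * d) * eval (deriv (deriv g)) (a + d)
  cubic-taylor = solve 6 (λ h₀ h₁ h₂ h₃ a d →
      2 ⊙ horner (h₀ ∷ h₁ ∷ h₂ ∷ h₃ ∷ []) (a :+ d) :+ 4 ⊙ (h₃ :* (d :* (d :* d)))
        := 2 ⊙ horner (h₀ ∷ h₁ ∷ h₂ ∷ h₃ ∷ []) a
           :+ d :* (2 ⊙ horner (1 ⊙ h₁ ∷ 2 ⊙ h₂ ∷ 3 ⊙ h₃ ∷ []) a)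
           :+ (d :* d) :* horner (1 ⊙ (2 ⊙ h₂) ∷ 2 ⊙ (3 ⊙ h₃) ∷ []) (a :+ d))
    refl
    where
    -- horner and ⊙ mirror eval and _·_, so that the solver's semantics unfolds to the goal.
    horner : ∀ {n} → List (Polynomial n) → Polynomial n → Polynomial n
    horner []       x = con 0
    horner (e ∷ es) x = e :+ x :* horner es x

    _⊙_ : ∀ {n} → ℕ → Polynomial n → Polynomial n
    0     ⊙ e = con 0
    suc k ⊙ e = e :+ k ⊙ e

  module _ (char0 : CharZero) where

    x≉0⇒[1+k]·x≉0 : ∀ k {x} → ¬ x ≈ 0# → ¬ suc k · x ≈ 0#
    x≉0⇒[1+k]·x≉0 k x≉0 kx≈0 = x≉0⇒y≉0⇒x*y≉0 (char0 k) x≉0 (trans (sym (k·x≈[k·1]*x (suc k) _)) kx≈0)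

    length-derivFrom : ∀ k f → length (derivFrom k f) ≡ length f
    length-derivFrom k []      = ≡.refl
    length-derivFrom k (a ∷ f) = ≡.cong suc (length-derivFrom (suc k) f)

    derivFrom-leading≉0 : ∀ k f d → length f ≡ suc d → ¬ coeff f d ≈ 0# →
                        ¬ coeff (derivFrom (suc k) f) d ≈ 0#
    derivFrom-leading≉0 k (a ∷ f) 0       _   a≉0 = x≉0⇒[1+k]·x≉0 k a≉0
    derivFrom-leading≉0 k (a ∷ f) (suc d) len f≉0 = derivFrom-leading≉0 (suc k) f d (suc-injective len) f≉0

    deriv-degree : ∀ f d → HasDegree f (suc d) → HasDegree (deriv f) d
    deriv-degree (a ∷ f) d (len , f≉0) =
      ≡.trans (length-derivFrom 1 f) (suc-injective len) , derivFrom-leading≉0 0 f d (suc-injective len) f≉0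

    deriv^-degree : ∀ j d f → HasDegree f (j ℕ.+ d) → HasDegree (deriv^ j f) d
    deriv^-degree 0       d f deg = deg
    deriv^-degree (suc j) d f deg =
      deriv-degree (deriv^ j f) d (deriv^-degree j (suc d) f (≡.subst (HasDegree f) (≡.sym (+-suc j d)) deg))

    cubic-other-root-not-inflection : ∀ g a b → HasDegree g 3 → ¬ a ≈ b →
      eval g a ≈ 0# → eval (deriv g) a ≈ 0# → eval g b ≈ 0# → ¬ eval (deriv (deriv g)) b ≈ 0#
    cubic-other-root-not-inflection g@(h₀ ∷ h₁ ∷ h₂ ∷ h₃ ∷ []) a b (_ , h₃≉0) a≉b ga≈0 g′a≈0 gb≈0 g″b≈0 =
      x≉0⇒[1+k]·x≉0 3 (x≉0⇒y≉0⇒x*y≉0 h₃≉0 (x≉0⇒y≉0⇒x*y≉0 d≉0 (x≉0⇒y≉0⇒x*y≉0 d≉0 d≉0))) (begin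
        4 · w                                   ≈⟨ +-identityˡ _ ⟨
        0# + 4 · w                              ≈⟨ +-congʳ (x≈0⇒k·x≈0 2 (trans (eval-congˡ g a+d≈b) gb≈0)) ⟨
        2 · eval g (a + d) + 4 · w              ≈⟨ cubic-taylor h₀ h₁ h₂ h₃ a d ⟩
        2 · eval g a + d * (2 · eval (deriv g) a) + (d * d) * eval (deriv (deriv g)) (a + d)
          ≈⟨ x≈0⇒y≈0⇒x+y≈0 (x≈0⇒y≈0⇒x+y≈0 (x≈0⇒k·x≈0 2 ga≈0) (y≈0⇒x*y≈0 d (x≈0⇒k·x≈0 2 g′a≈0)))
                            (y≈0⇒x*y≈0 (d * d) (trans (eval-congˡ (deriv (deriv g)) a+d≈b) g″b≈0)) ⟩
        0#                                      ∎)
      where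
      d = b - a
      w = h₃ * (d * (d * d))
      d≉0 : ¬ d ≈ 0#
      d≉0 = a≉b ∘ sym ∘ x∙y⁻¹≈ε⇒x≈y b a
      a+d≈b : a + d ≈ b
      a+d≈b = trans (sym (+-assoc a b (- a))) (xyx⁻¹≈y a b)

theorem9 : ∀ {c ℓ : Level} (F : Field c ℓ) → FieldTheory.CharZero F →
    (n : ℕ) → 3 ≤ n → (M : Fin 2 → Fin (suc n) → ℕ) → IsMultiplicityMatrix M →
    (∀ j → toℕ j ≡ n ∸ 3 → (M zero j ≡ 2) × (M (suc zero) j ≡ 1)) →
    (∀ j → toℕ j ≡ n ∸ 2 → (M zero j ≡ 1) × (M (suc zero) j ≡ 0)) →
    (∀ j → toℕ j ≡ n ∸ 1 → (M zero j ≡ 0) × (M (suc zero) j ≡ 1)) →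
    (∀ j → toℕ j ≡ n → (M zero j ≡ 0) × (M (suc zero) j ≡ 0)) →
    ¬ (Σ (FieldTheory.Poly F) λ f → Σ (Fin 2 → Field.Carrier F) λ Λ →
    FieldTheory.Distinct F Λ × FieldTheory.IsMultMatrixOf F M f Λ)
theorem9 F char0 (suc (suc (suc m))) (ℕ.s≤s (ℕ.s≤s (ℕ.s≤s _))) M _ col₃ col₂ col₁ _ (f , Λ , distinct , degree , mult) =
  cubic-other-root-not-inflection F char0 (deriv^ m f) (Λ zero) (Λ (suc zero))
    (deriv^-degree F char0 m 3 f (≡.subst (HasDegree f) (+-comm 3 m) degree))
    (distinct zero (suc zero) λ ())
    (vanishes zero       1 (m<n+m m {4} ℕ.z<s)             (λ j → proj₁ ∘ col₃ j))
    (vanishes zero       0 (m<n+m (suc m) {3} ℕ.z<s)       (λ j → proj₁ ∘ col₂ j))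
    (vanishes (suc zero) 0 (m<n+m m {4} ℕ.z<s)             (λ j → proj₂ ∘ col₃ j))
    (vanishes (suc zero) 0 (m<n+m (suc (suc m)) {2} ℕ.z<s) (λ j → proj₂ ∘ col₁ j))
  where
  open FieldTheory F using (HasDegree; deriv^)
  open Field F using (_≈_; 0#)

  vanishes : ∀ i k {t} → t ℕ.< 4 ℕ.+ m → (∀ j → toℕ j ≡ t → M i j ≡ suc k) →
             eval F (deriv^ t f) (Λ i) ≈ 0#
  vanishes i k {t} t<n entry = divisor-root F (Λ i) k (deriv^ t f) (proj₁
    (≡.subst₂ (λ t k → FieldTheory.Multiplicity F (deriv^ t f) (Λ i) k)
              (toℕ-fromℕ< t<n) (entry j (toℕ-fromℕ< t<n)) (mult i j)))
    where
    j = fromℕ< t<n
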